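{- Let $k$ and $t$ be positive integers with $t\geqslant k$, and let $N_1,N_2,\ldots,N_t$ be matroids on the same finite ground set $E$ such that $\chi(N_i)\leqslant k$ for all $i=1,2,\ldots,t$. Suppose that to each element $e\in E$ a list $L(e)\subseteq\{1,2,\ldots,t\}$ with $|L(e)|=k$ is assigned. Then there is a coloring $f:E\rightarrow\{1,2,\ldots,t\}$ such that (i) $f(e)\in L(e)$ for every $e\in E$, and (ii) $f^{ -1}(i)$ is independent in $N_i$ for all $i=1,2,\ldots,t$.
   Context: For a matroid $M$ on a finite set $E$, a coloring of $E$ is proper if each color class is independent in $M$; the chromatic number $\chi(M)$ is the least number of colors in a proper coloring of $E$, i.e. the least number of independent sets of $M$ whose union is $E$. Matroids are tacitly assumed to have no loops, so that $\chi(M)$ is finite. -}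

module Defs where

open import Level using (Level; suc; _⊔_)
open import Data.Nat using (ℕ; _<_)
open import Data.Fin using (Fin; _≟_)
open import Data.Fin.Subset using (Subset; ⊥; _⊆_; _∈_; _∉_; ∣_∣; ⁅_⁆; _∪_)
open import Data.Vec using (tabulate)
open import Data.Product using (Σ; ∃; _×_)
open import Relation.Nullary using (does)

record Matroid (n : ℕ) : Set₁ where
  field
    Independent : Subset n → Set
    empty-indep : Independent ⊥
    hereditary  : ∀ {A B} → A ⊆ B → Independent B → Independent A
    augment     : ∀ {A B} → Independent A → Independent B → ∣ A ∣ < ∣ B ∣ →
                  ∃ λ e → e ∈ B × e ∉ A × Independent (⁅ e ⁆ ∪ A)

open Matroid public

colourClass : ∀ {n m} → (Fin n → Fin m) → Fin m → Subset n
colourClass f i = tabulate (λ e → does (f e ≟ i))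

ProperColouring : ∀ {n k} → Matroid n → (Fin n → Fin k) → Set
ProperColouring M c = ∀ i → Independent M (colourClass c i)

-- χ(M) ≤ k : E is the union of k independent sets, i.e. there is a proper
-- colouring of E with k colours.
χ≤ : ∀ {n} → Matroid n → ℕ → Set
χ≤ {n} M k = Σ (Fin n → Fin k) (ProperColouring M)

{-# OPTIONS --safe #-}
module Submission where

-- The theorem is an instance of Rado's theorem for matroids: lists L admit a colouring f with
-- f e ∈ L e and every f⁻¹(i) independent in Nᵢ as soon as ∣A∣ ≤ Σᵢ rᵢ(A ∩ L⁻¹(i)) for all A ⊆ E.
-- Here the condition follows by double counting: a k-colouring of Nᵢ gives ∣X∣ ≤ k·rᵢ(X), and
-- ∣L e∣ = k gives k∣A∣ = Σᵢ ∣A ∩ L⁻¹(i)∣. Rado's theorem is proved by shrinking lists: if L e₀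
-- contains i₁ ≠ i₂ and dropping either one violates the condition, at A₁ resp. A₂, then both sets
-- contain e₀, and submodularity of the ranks at A₁ ∪ A₂ and (A₁ ∩ A₂) - e₀ contradicts the
-- condition for L itself.
-- Independence in Nᵢ is not decidable, so rᵢ is the rank of a decidable matroid squeezed between
-- the colour classes of a k-colouring of Nᵢ and Nᵢ itself: the subsets of those classes, closed
-- under the augmentation axiom of Nᵢ, which terminates as there are finitely many subsets.

open import Defs
open import Data.Bool using (Bool; true; false; _∧_; _∨_)
open import Data.Nat using (ℕ; zero; suc; _+_; _*_; _≤_; _<_; s≤s; z≤n; _≤?_; _<?_; NonZero)
open import Data.Nat.Properties
  using (module ≤-Reasoning; +-*-semiring; ≤-refl; ≤-trans; ≤-reflexive; <-≤-trans; ≤-pred; +-mono-≤; +-monoˡ-≤; +-monoʳ-≤;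
         +-mono-<-≤; +-mono-≤-<; +-identityʳ; *-zeroʳ; *-identityʳ; *-identityˡ; *-cancelˡ-≤; +-suc; m≤m+n; n≤0⇒n≡0;
         <⇒≱; ≰⇒>; ≮⇒≥)
open import Data.Fin using (Fin; zero; suc; _≟_; punchIn)
open import Data.Fin.Properties using (any?; punchInᵢ≢i)
open import Data.Fin.Subset
open import Data.Fin.Subset.Properties
open import Data.Vec using (lookup; tabulate; []; _∷_)
open import Data.Vec.Properties using (lookup-zipWith; lookup∘tabulate; lookup⇒[]=; []=⇒lookup)
open import Data.Product using (Σ; ∃; ∃₂; _×_; _,_; proj₁; proj₂)
open import Data.Sum as Sum using (_⊎_; inj₁; inj₂; [_,_]′)
open import Data.List as List using (List; []; _∷_; allFin)
import Data.List.Relation.Unary.All.Properties as Allₚ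
open import Data.List.Relation.Unary.Any as Any using (Any; here; there)
open import Data.List.Relation.Unary.All as All using (All; _∷_)
open import Induction.WellFounded using (Acc; acc)
open import Data.Nat.Induction using (<-wellFounded)
open import Data.List.Membership.Propositional using () renaming (_∈_ to _∈ₗ_)
open import Data.List.Membership.Propositional.Properties using (∈-allFin)
open import Function using (_∘_; flip)
open import Relation.Nullary using (¬_; Dec; yes; no; does; contradiction)
open import Relation.Nullary.Decidable using (dec-true; _×-dec_; ¬?)
open import Relation.Unary using (Pred; Decidable)
open import Relation.Binary.PropositionalEquality
  using (_≡_; _≢_; refl; sym; trans; cong; cong₂; subst; subst₂; module ≡-Reasoning)
open import Algebra.Properties.Semiring.Sum +-*-semiring
  using (sum-syntax; ∑-comm; ∑-distrib-+; *-distribˡ-sum; sum-cong-≗; sum-remove; sum-replicate-zero)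

private variable
  n m : ℕ
  p q : Subset n

∪-monoʳ-⊆ : ∀ (p : Subset n) {q r} → q ⊆ r → p ∪ q ⊆ p ∪ r
∪-monoʳ-⊆ p {q} q⊆r x∈p∪q with x∈p∪q⁻ p q x∈p∪q
... | inj₁ x∈p = x∈p∪q⁺ (inj₁ x∈p)
... | inj₂ x∈q = x∈p∪q⁺ (inj₂ (q⊆r x∈q))

∪-lub : ∀ {p q r : Subset n} → p ⊆ r → q ⊆ r → p ∪ q ⊆ r
∪-lub {p = p} {q} p⊆r q⊆r x∈p∪q = [ p⊆r , q⊆r ]′ (x∈p∪q⁻ p q x∈p∪q)

p⊆q∪r⇒p⊆p∩q∪p∩r : ∀ {p q r : Subset n} → p ⊆ q ∪ r → p ⊆ (p ∩ q) ∪ (p ∩ r)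
p⊆q∪r⇒p⊆p∩q∪p∩r {q = q} {r} p⊆q∪r x∈p =
  x∈p∪q⁺ (Sum.map (λ x∈q → x∈p∩q⁺ (x∈p , x∈q)) (λ x∈r → x∈p∩q⁺ (x∈p , x∈r)) (x∈p∪q⁻ q r (p⊆q∪r x∈p)))

x∈p⇒⁅x⁆⊆p : ∀ {x} {p : Subset n} → x ∈ p → ⁅ x ⁆ ⊆ p
x∈p⇒⁅x⁆⊆p {x = x} x∈p y∈⁅x⁆ = subst (_∈ _) (sym (x∈⁅y⁆⇒x≡y x y∈⁅x⁆)) x∈p

module _ {ℓ} {P : Pred (Fin n) ℓ} (P? : Decidable P) {x : Fin n} where

  ∈-tabulate⁺ : P x → x ∈ tabulate (λ y → does (P? y))
  ∈-tabulate⁺ Px = lookup⇒[]= x _ (trans (lookup∘tabulate _ x) (dec-true (P? x) Px))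

  ∈-tabulate⁻ : x ∈ tabulate (λ y → does (P? y)) → P x
  ∈-tabulate⁻ x∈ with P? x | trans (sym (lookup∘tabulate _ x)) ([]=⇒lookup x∈)
  ... | yes Px | _ = Px

tabulate-≟≡⁅⁆ : (x : Fin n) → tabulate (λ y → does (x ≟ y)) ≡ ⁅ x ⁆
tabulate-≟≡⁅⁆ x = ⊆-antisym
  (λ y∈ → subst (_∈ ⁅ x ⁆) (∈-tabulate⁻ (x ≟_) y∈) (x∈⁅x⁆ x))
  (λ y∈⁅x⁆ → ∈-tabulate⁺ (x ≟_) (sym (x∈⁅y⁆⇒x≡y x y∈⁅x⁆)))

tabulate-∈?≡ : (p : Subset n) → tabulate (λ x → does (x ∈? p)) ≡ p
tabulate-∈?≡ p = ⊆-antisym (∈-tabulate⁻ (_∈? p)) (∈-tabulate⁺ (_∈? p))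

𝟙 : Bool → ℕ
𝟙 true  = 1
𝟙 false = 0

∣p∣≡∑𝟙 : (p : Subset n) → ∣ p ∣ ≡ ∑[ x < n ] 𝟙 (lookup p x)
∣p∣≡∑𝟙 []            = refl
∣p∣≡∑𝟙 (inside  ∷ p) = cong suc (∣p∣≡∑𝟙 p)
∣p∣≡∑𝟙 (outside ∷ p) = ∣p∣≡∑𝟙 p

𝟙-∨+𝟙-∧ : ∀ a b → 𝟙 (a ∨ b) + 𝟙 (a ∧ b) ≡ 𝟙 a + 𝟙 b
𝟙-∨+𝟙-∧ true  true  = refl
𝟙-∨+𝟙-∧ true  false = refl
𝟙-∨+𝟙-∧ false b     = +-identityʳ (𝟙 b)

∣p∪q∣+∣p∩q∣≡∣p∣+∣q∣ : (p q : Subset n) → ∣ p ∪ q ∣ + ∣ p ∩ q ∣ ≡ ∣ p ∣ + ∣ q ∣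
∣p∪q∣+∣p∩q∣≡∣p∣+∣q∣ {n} p q = begin
  ∣ p ∪ q ∣ + ∣ p ∩ q ∣
    ≡⟨ cong₂ _+_ (∣p∣≡∑𝟙 (p ∪ q)) (∣p∣≡∑𝟙 (p ∩ q)) ⟩
  ∑[ x < n ] 𝟙 (lookup (p ∪ q) x) + ∑[ x < n ] 𝟙 (lookup (p ∩ q) x)
    ≡⟨ sym (∑-distrib-+ (𝟙 ∘ lookup (p ∪ q)) (𝟙 ∘ lookup (p ∩ q))) ⟩
  ∑[ x < n ] (𝟙 (lookup (p ∪ q) x) + 𝟙 (lookup (p ∩ q) x))
    ≡⟨ sum-cong-≗ pointwise ⟩
  ∑[ x < n ] (𝟙 (lookup p x) + 𝟙 (lookup q x))
    ≡⟨ ∑-distrib-+ (𝟙 ∘ lookup p) (𝟙 ∘ lookup q) ⟩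
  ∑[ x < n ] 𝟙 (lookup p x) + ∑[ x < n ] 𝟙 (lookup q x)
    ≡⟨ sym (cong₂ _+_ (∣p∣≡∑𝟙 p) (∣p∣≡∑𝟙 q)) ⟩
  ∣ p ∣ + ∣ q ∣ ∎
  where
  open ≡-Reasoning
  pointwise : ∀ x → 𝟙 (lookup (p ∪ q) x) + 𝟙 (lookup (p ∩ q) x) ≡ 𝟙 (lookup p x) + 𝟙 (lookup q x)
  pointwise x rewrite lookup-zipWith _∨_ x p q | lookup-zipWith _∧_ x p q = 𝟙-∨+𝟙-∧ (lookup p x) (lookup q x)

∣p∪q∣≤∣p∣+∣q∣ : (p q : Subset n) → ∣ p ∪ q ∣ ≤ ∣ p ∣ + ∣ q ∣
∣p∪q∣≤∣p∣+∣q∣ p q = ≤-trans (m≤m+n _ _) (≤-reflexive (∣p∪q∣+∣p∩q∣≡∣p∣+∣q∣ p q))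

∣p∣<∣q∣⇒∃q─p : ∣ p ∣ < ∣ q ∣ → ∃ λ x → x ∈ q × x ∉ p
∣p∣<∣q∣⇒∃q─p {p = p} {q} ∣p∣<∣q∣ with any? (λ x → x ∈? q ×-dec ¬? (x ∈? p))
... | yes witness = witness
... | no ∄ = contradiction (p⊆q⇒∣p∣≤∣q∣ q⊆p) (<⇒≱ ∣p∣<∣q∣)
  where
  q⊆p : q ⊆ p
  q⊆p {x} x∈q with x ∈? p
  ... | yes x∈p = x∈p
  ... | no  x∉p = contradiction (x , x∈q , x∉p) ∄

2≤∣p∣⇒∃≢ : 2 ≤ ∣ p ∣ → ∃₂ λ x y → x ∈ p × y ∈ p × x ≢ y
2≤∣p∣⇒∃≢ {n} {p} 2≤∣p∣
  with ∣p∣<∣q∣⇒∃q─p {p = ⊥} (<-≤-trans (s≤s (≤-reflexive (∣⊥∣≡0 n))) (≤-trans (s≤s z≤n) 2≤∣p∣))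
... | x , x∈p , _
  with ∣p∣<∣q∣⇒∃q─p {p = ⁅ x ⁆} (≤-trans (≤-reflexive (cong suc (∣⁅x⁆∣≡1 x))) 2≤∣p∣)
... | y , y∈p , y∉⁅x⁆ = x , y , x∈p , y∈p , x∉⁅y⁆⇒x≢y y∉⁅x⁆ ∘ sym

∣p∣≤1⇒≡ : ∀ {x y} → ∣ p ∣ ≤ 1 → x ∈ p → y ∈ p → x ≡ y
∣p∣≤1⇒≡ {x = x} {y} ∣p∣≤1 x∈p y∈p with x ≟ y
... | yes x≡y = x≡y
... | no  x≢y = contradiction ∣p∣≤1 (<⇒≱ (subst (_< _) (∣⁅x⁆∣≡1 x) ⁅x⁆⊂p))
  where ⁅x⁆⊂p = p⊂q⇒∣p∣<∣q∣ (x∈p⇒⁅x⁆⊆p x∈p , y , y∈p , x≢y⇒x∉⁅y⁆ (x≢y ∘ sym))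

∣p∣+∣q∣≤∣p∪q∣+1+∣p∩q-x∣ : (p q : Subset n) (x : Fin n) → ∣ p ∣ + ∣ q ∣ ≤ ∣ p ∪ q ∣ + suc ∣ (p ∩ q) ∩ ∁ ⁅ x ⁆ ∣
∣p∣+∣q∣≤∣p∪q∣+1+∣p∩q-x∣ p q x = begin
  ∣ p ∣ + ∣ q ∣                              ≡⟨ sym (∣p∪q∣+∣p∩q∣≡∣p∣+∣q∣ p q) ⟩
  ∣ p ∪ q ∣ + ∣ p ∩ q ∣                      ≤⟨ +-monoʳ-≤ ∣ p ∪ q ∣ (p⊆q⇒∣p∣≤∣q∣ p∩q⊆⁅x⁆∪r) ⟩
  ∣ p ∪ q ∣ + ∣ ⁅ x ⁆ ∪ r ∣                  ≤⟨ +-monoʳ-≤ ∣ p ∪ q ∣ (∣p∪q∣≤∣p∣+∣q∣ ⁅ x ⁆ r) ⟩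
  ∣ p ∪ q ∣ + (∣ ⁅ x ⁆ ∣ + ∣ r ∣)            ≡⟨ cong (λ s → ∣ p ∪ q ∣ + (s + ∣ r ∣)) (∣⁅x⁆∣≡1 x) ⟩
  ∣ p ∪ q ∣ + suc ∣ r ∣ ∎
  where
  open ≤-Reasoning
  r = (p ∩ q) ∩ ∁ ⁅ x ⁆
  p∩q⊆⁅x⁆∪r : p ∩ q ⊆ ⁅ x ⁆ ∪ r
  p∩q⊆⁅x⁆∪r {y} y∈p∩q with y ≟ x
  ... | yes refl = x∈p∪q⁺ (inj₁ (x∈⁅x⁆ y))
  ... | no  y≢x  = x∈p∪q⁺ (inj₂ (x∈p∩q⁺ (y∈p∩q , x∉p⇒x∈∁p (x≢y⇒x∉⁅y⁆ y≢x))))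

∑-mono-≤ : {f g : Fin n → ℕ} → (∀ i → f i ≤ g i) → ∑[ i < n ] f i ≤ ∑[ i < n ] g i
∑-mono-≤ {zero}  f≤g = z≤n
∑-mono-≤ {suc n} f≤g = +-mono-≤ (f≤g zero) (∑-mono-≤ (f≤g ∘ suc))

∑-mono-< : {f g : Fin n → ℕ} → (∀ i → f i ≤ g i) → ∀ j → f j < g j → ∑[ i < n ] f i < ∑[ i < n ] g i
∑-mono-< f≤g zero    fj<gj = +-mono-<-≤ fj<gj (∑-mono-≤ (f≤g ∘ suc))
∑-mono-< f≤g (suc j) fj<gj = +-mono-≤-< (f≤g zero) (∑-mono-< (f≤g ∘ suc) j fj<gj)

∑-const : ∀ n c → ∑[ i < n ] c ≡ n * c
∑-const zero    c = refl
∑-const (suc n) c = cong (c +_) (∑-const n c)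

∑-supported-at : ∀ {f : Fin n → ℕ} i → (∀ j → j ≢ i → f j ≡ 0) → ∑[ j < n ] f j ≡ f i
∑-supported-at {suc n} {f} i f≡0 = begin
  ∑[ j < suc n ] f j                       ≡⟨ sum-remove f ⟩
  f i + ∑[ j < n ] f (punchIn i j)         ≡⟨ cong (f i +_) (sum-cong-≗ (λ j → f≡0 _ (punchInᵢ≢i i j))) ⟩
  f i + ∑[ j < n ] 0                       ≡⟨ cong (f i +_) (sum-replicate-zero n) ⟩
  f i + 0                                  ≡⟨ +-identityʳ (f i) ⟩
  f i ∎
  where open ≡-Reasoning

∑∣A∩column∣≡k*∣A∣ : (R : Fin n → Fin m → Bool) (A : Subset n) {k : ℕ} →
                    (∀ {e} → e ∈ A → ∣ tabulate (R e) ∣ ≡ k) →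
                    ∑[ j < m ] ∣ A ∩ tabulate (λ e → R e j) ∣ ≡ k * ∣ A ∣
∑∣A∩column∣≡k*∣A∣ {n} {m} R A {k} rows = begin
  ∑[ j < m ] ∣ A ∩ tabulate (λ e → R e j) ∣
    ≡⟨ sum-cong-≗ (λ j → trans (∣p∣≡∑𝟙 (A ∩ column j)) (sum-cong-≗ (entry j))) ⟩
  ∑[ j < m ] ∑[ e < n ] 𝟙 (lookup A e ∧ R e j)
    ≡⟨ ∑-comm (λ j e → 𝟙 (lookup A e ∧ R e j)) ⟩
  ∑[ e < n ] ∑[ j < m ] 𝟙 (lookup A e ∧ R e j)
    ≡⟨ sum-cong-≗ row-sum ⟩
  ∑[ e < n ] (k * 𝟙 (lookup A e))
    ≡⟨ sym (*-distribˡ-sum k (𝟙 ∘ lookup A)) ⟩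
  k * ∑[ e < n ] 𝟙 (lookup A e)
    ≡⟨ cong (k *_) (sym (∣p∣≡∑𝟙 A)) ⟩
  k * ∣ A ∣ ∎
  where
  open ≡-Reasoning
  column : Fin m → Subset n
  column j = tabulate (λ e → R e j)
  entry : ∀ j e → 𝟙 (lookup (A ∩ column j) e) ≡ 𝟙 (lookup A e ∧ R e j)
  entry j e rewrite lookup-zipWith _∧_ e A (column j) | lookup∘tabulate (λ e → R e j) e = refl
  row-sum : ∀ e → ∑[ j < m ] 𝟙 (lookup A e ∧ R e j) ≡ k * 𝟙 (lookup A e)
  row-sum e with lookup A e in Ae
  ... | true = begin
    ∑[ j < m ] 𝟙 (R e j)                     ≡⟨ sum-cong-≗ (λ j → cong 𝟙 (sym (lookup∘tabulate (R e) j))) ⟩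
    ∑[ j < m ] 𝟙 (lookup (tabulate (R e)) j) ≡⟨ sym (∣p∣≡∑𝟙 (tabulate (R e))) ⟩
    ∣ tabulate (R e) ∣                        ≡⟨ rows (lookup⇒[]= e A Ae) ⟩
    k                                         ≡⟨ sym (*-identityʳ k) ⟩
    k * 1 ∎
  ... | false = trans (sum-replicate-zero m) (sym (*-zeroʳ k))

countSubsets : ∀ {ℓ} {P : Pred (Subset n) ℓ} → Decidable P → ℕ
countSubsets {zero}  P? = 𝟙 (does (P? []))
countSubsets {suc n} P? = countSubsets (P? ∘ (inside ∷_)) + countSubsets (P? ∘ (outside ∷_))

module _ {ℓ ℓ′} {A : Set ℓ} {B : Set ℓ′} where

  𝟙-does-mono : (A? : Dec A) (B? : Dec B) → (A → B) → 𝟙 (does A?) ≤ 𝟙 (does B?)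
  𝟙-does-mono (yes _) (yes _) _   = ≤-refl
  𝟙-does-mono (yes a) (no ¬b) A→B = contradiction (A→B a) ¬b
  𝟙-does-mono (no _)  _       _   = z≤n

  𝟙-does-< : (A? : Dec A) (B? : Dec B) → ¬ A → B → 𝟙 (does A?) < 𝟙 (does B?)
  𝟙-does-< (yes a) _       ¬a _ = contradiction a ¬a
  𝟙-does-< (no _)  (yes _) _  _ = s≤s z≤n
  𝟙-does-< (no _)  (no ¬b) _  b = contradiction b ¬b

countSubsets-mono : ∀ {ℓ ℓ′} {P : Pred (Subset n) ℓ} {Q : Pred (Subset n) ℓ′}
                    (P? : Decidable P) (Q? : Decidable Q) → (∀ {p} → P p → Q p) →
                    countSubsets P? ≤ countSubsets Q?
countSubsets-mono {zero}  P? Q? P⇒Q = 𝟙-does-mono (P? []) (Q? []) P⇒Q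
countSubsets-mono {suc n} P? Q? P⇒Q =
  +-mono-≤ (countSubsets-mono (P? ∘ (inside ∷_)) (Q? ∘ (inside ∷_)) P⇒Q)
           (countSubsets-mono (P? ∘ (outside ∷_)) (Q? ∘ (outside ∷_)) P⇒Q)

countSubsets-mono-< : ∀ {ℓ ℓ′} {P : Pred (Subset n) ℓ} {Q : Pred (Subset n) ℓ′}
                      (P? : Decidable P) (Q? : Decidable Q) → (∀ {p} → P p → Q p) →
                      ∀ p → ¬ P p → Q p → countSubsets P? < countSubsets Q?
countSubsets-mono-< P? Q? P⇒Q []            ¬Pp Qp = 𝟙-does-< (P? []) (Q? []) ¬Pp Qp
countSubsets-mono-< P? Q? P⇒Q (inside  ∷ p) ¬Pp Qp =
  +-mono-<-≤ (countSubsets-mono-< (P? ∘ (inside ∷_)) (Q? ∘ (inside ∷_)) P⇒Q p ¬Pp Qp)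
             (countSubsets-mono (P? ∘ (outside ∷_)) (Q? ∘ (outside ∷_)) P⇒Q)
countSubsets-mono-< P? Q? P⇒Q (outside ∷ p) ¬Pp Qp =
  +-mono-≤-< (countSubsets-mono (P? ∘ (inside ∷_)) (Q? ∘ (inside ∷_)) P⇒Q)
             (countSubsets-mono-< (P? ∘ (outside ∷_)) (Q? ∘ (outside ∷_)) P⇒Q p ¬Pp Qp)

record DecidableMatroid (n : ℕ) : Set₁ where
  field
    matroid      : Matroid n
    independent? : Decidable (Independent matroid)

module Rank {n} (M : DecidableMatroid n) where

  open DecidableMatroid M

  private variable
    G X Y : Subset n

  MaximalIn : Subset n → Subset n → Set
  MaximalIn X G = ∀ {e} → e ∈ X → e ∉ G → ¬ Independent matroid (⁅ e ⁆ ∪ G)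

  maximal⇒largest : Independent matroid G → MaximalIn X G → Independent matroid Y → Y ⊆ X → ∣ Y ∣ ≤ ∣ G ∣
  maximal⇒largest {G} {Y = Y} indG maxG indY Y⊆X with ∣ Y ∣ ≤? ∣ G ∣
  ... | yes ∣Y∣≤∣G∣ = ∣Y∣≤∣G∣
  ... | no  ∣Y∣≰∣G∣ with augment matroid indG indY (≰⇒> ∣Y∣≰∣G∣)
  ...   | e , e∈Y , e∉G , indeG = contradiction indeG (maxG (Y⊆X e∈Y) e∉G)

  greedy : Subset n → List (Fin n) → Subset n → Subset n
  greedy X []       G = G
  greedy X (e ∷ es) G with e ∈? X ×-dec independent? (⁅ e ⁆ ∪ G)
  ... | yes _ = greedy X es (⁅ e ⁆ ∪ G)
  ... | no  _ = greedy X es G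

  greedy-independent : ∀ es → Independent matroid G → Independent matroid (greedy X es G)
  greedy-independent []                 indG = indG
  greedy-independent {G} {X} (e ∷ es) indG with e ∈? X ×-dec independent? (⁅ e ⁆ ∪ G)
  ... | yes (_ , indeG) = greedy-independent es indeG
  ... | no  _           = greedy-independent es indG

  greedy-⊇ : ∀ es → G ⊆ greedy X es G
  greedy-⊇ []                 = λ x∈G → x∈G
  greedy-⊇ {G} {X} (e ∷ es) with e ∈? X ×-dec independent? (⁅ e ⁆ ∪ G)
  ... | yes _ = ⊆-trans (q⊆p∪q ⁅ e ⁆ G) (greedy-⊇ es)
  ... | no  _ = greedy-⊇ es

  greedy-⊆ : ∀ es → G ⊆ X → greedy X es G ⊆ X
  greedy-⊆ []                 G⊆X = G⊆X
  greedy-⊆ {G} {X} (e ∷ es) G⊆X with e ∈? X ×-dec independent? (⁅ e ⁆ ∪ G)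
  ... | yes (e∈X , _) = greedy-⊆ es (∪-lub (x∈p⇒⁅x⁆⊆p e∈X) G⊆X)
  ... | no  _         = greedy-⊆ es G⊆X

  greedy-maximal : ∀ es {e} → e ∈ₗ es → e ∈ X → e ∉ greedy X es G → ¬ Independent matroid (⁅ e ⁆ ∪ greedy X es G)
  greedy-maximal {X} {G} (e ∷ es) (here refl) e∈X e∉ with e ∈? X ×-dec independent? (⁅ e ⁆ ∪ G)
  ... | yes _   = contradiction (greedy-⊇ es (x∈p∪q⁺ (inj₁ (x∈⁅x⁆ e)))) e∉
  ... | no  ¬ok = λ ind → ¬ok (e∈X , hereditary matroid (∪-monoʳ-⊆ ⁅ e ⁆ (greedy-⊇ es)) ind)
  greedy-maximal {X} {G} (f ∷ es) (there e∈es) e∈X e∉ with f ∈? X ×-dec independent? (⁅ f ⁆ ∪ G)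
  ... | yes _ = greedy-maximal es e∈es e∈X e∉
  ... | no  _ = greedy-maximal es e∈es e∈X e∉

  extend : Subset n → Subset n → Subset n
  extend X G = greedy X (allFin n) G

  extend-maximal : MaximalIn X (extend X G)
  extend-maximal {e = e} = greedy-maximal (allFin n) (∈-allFin e)

  basis : Subset n → Subset n
  basis X = extend X ⊥

  basis-independent : Independent matroid (basis X)
  basis-independent = greedy-independent (allFin n) (empty-indep matroid)

  basis-⊆ : basis X ⊆ X
  basis-⊆ = greedy-⊆ (allFin n) ⊥⊆

  rank : Subset n → ℕ
  rank X = ∣ basis X ∣

  independent⇒∣∣≤rank : Independent matroid Y → Y ⊆ X → ∣ Y ∣ ≤ rank X
  independent⇒∣∣≤rank indY Y⊆X = maximal⇒largest basis-independent extend-maximal indY Y⊆X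

  rank-mono : X ⊆ Y → rank X ≤ rank Y
  rank-mono X⊆Y = independent⇒∣∣≤rank basis-independent (⊆-trans basis-⊆ X⊆Y)

  rank≤∣∣ : rank X ≤ ∣ X ∣
  rank≤∣∣ = p⊆q⇒∣p∣≤∣q∣ basis-⊆

  rank-Empty : Empty X → rank X ≡ 0
  rank-Empty {X} empty = n≤0⇒n≡0 (≤-trans rank≤∣∣ (≤-reflexive (trans (cong ∣_∣ (Empty-unique empty)) (∣⊥∣≡0 n))))

  ∣∣≤rank⇒independent : ∣ X ∣ ≤ rank X → Independent matroid X
  ∣∣≤rank⇒independent {X} ∣X∣≤rank = hereditary matroid X⊆basis basis-independent
    where
    X⊆basis : X ⊆ basis X
    X⊆basis {e} e∈X with e ∈? basis X
    ... | yes e∈basis = e∈basis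
    ... | no  e∉basis = contradiction ∣X∣≤rank (<⇒≱ (p⊂q⇒∣p∣<∣q∣ (basis-⊆ , e , e∈X , e∉basis)))

  rank-submodular : ∀ A B → rank (A ∪ B) + rank (A ∩ B) ≤ rank A + rank B
  rank-submodular A B = begin
    rank (A ∪ B) + rank (A ∩ B)
      ≤⟨ +-monoˡ-≤ (rank (A ∩ B)) (maximal⇒largest G₁-independent extend-maximal basis-independent basis-⊆) ⟩
    ∣ G₁ ∣ + ∣ G₀ ∣
      ≤⟨ +-mono-≤ (p⊆q⇒∣p∣≤∣q∣ G₁⊆) (p⊆q⇒∣p∣≤∣q∣ G₀⊆) ⟩
    ∣ (G₁ ∩ A) ∪ (G₁ ∩ B) ∣ + ∣ (G₁ ∩ A) ∩ (G₁ ∩ B) ∣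
      ≡⟨ ∣p∪q∣+∣p∩q∣≡∣p∣+∣q∣ (G₁ ∩ A) (G₁ ∩ B) ⟩
    ∣ G₁ ∩ A ∣ + ∣ G₁ ∩ B ∣
      ≤⟨ +-mono-≤ (independent⇒∣∣≤rank (restrict A) (p∩q⊆q G₁ A)) (independent⇒∣∣≤rank (restrict B) (p∩q⊆q G₁ B)) ⟩
    rank A + rank B ∎
    where
    open ≤-Reasoning
    G₀ = basis (A ∩ B)
    G₁ = extend (A ∪ B) G₀
    G₁-independent : Independent matroid G₁
    G₁-independent = greedy-independent (allFin n) basis-independent
    restrict : ∀ C → Independent matroid (G₁ ∩ C)
    restrict C = hereditary matroid (p∩q⊆p G₁ C) G₁-independent
    G₁⊆ : G₁ ⊆ (G₁ ∩ A) ∪ (G₁ ∩ B)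
    G₁⊆ = p⊆q∪r⇒p⊆p∩q∪p∩r (greedy-⊆ (allFin n) (⊆-trans basis-⊆ (⊆-trans (p∩q⊆p A B) (p⊆p∪q B))))
    G₀⊆ : G₀ ⊆ (G₁ ∩ A) ∩ (G₁ ∩ B)
    G₀⊆ x∈G₀ with x∈p∩q⁻ A B (basis-⊆ x∈G₀) | greedy-⊇ (allFin n) x∈G₀
    ... | x∈A , x∈B | x∈G₁ = x∈p∩q⁺ (x∈p∩q⁺ (x∈G₁ , x∈A) , x∈p∩q⁺ (x∈G₁ , x∈B))

  rank-submodular-⊆ : ∀ {A B X Y} → X ⊆ A ∪ B → Y ⊆ A ∩ B → rank X + rank Y ≤ rank A + rank B
  rank-submodular-⊆ {A} {B} X⊆ Y⊆ = ≤-trans (+-mono-≤ (rank-mono X⊆) (rank-mono Y⊆)) (rank-submodular A B)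

  ∣∣≤k*rank : ∀ {k} → χ≤ matroid k → ∀ X → ∣ X ∣ ≤ k * rank X
  ∣∣≤k*rank {k} (c , proper) X = begin
    ∣ X ∣                              ≡⟨ sym (*-identityˡ ∣ X ∣) ⟩
    1 * ∣ X ∣                          ≡⟨ sym (∑∣A∩column∣≡k*∣A∣ (λ e j → does (c e ≟ j)) X singleton-rows) ⟩
    ∑[ j < k ] ∣ X ∩ colourClass c j ∣ ≤⟨ ∑-mono-≤ (λ j → independent⇒∣∣≤rank (X∩class-independent j) (p∩q⊆p X _)) ⟩
    ∑[ j < k ] rank X                  ≡⟨ ∑-const k (rank X) ⟩
    k * rank X ∎
    where
    open ≤-Reasoning
    X∩class-independent : ∀ j → Independent matroid (X ∩ colourClass c j)
    X∩class-independent j = hereditary matroid (p∩q⊆q X _) (proper j)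
    singleton-rows : ∀ {e} → e ∈ X → ∣ tabulate (λ j → does (c e ≟ j)) ∣ ≡ 1
    singleton-rows {e} _ = trans (cong ∣_∣ (tabulate-≟≡⁅⁆ (c e))) (∣⁅x⁆∣≡1 (c e))

record DecidableRefinement {n} (N : Matroid n) (k : ℕ) : Set₁ where
  field
    refinement : DecidableMatroid n
    sound      : ∀ {A} → Independent (DecidableMatroid.matroid refinement) A → Independent N A
    colourable : χ≤ (DecidableMatroid.matroid refinement) k

module Saturation {n} (N : Matroid n) where

  private variable
    A B : Subset n
    Ks : List (Subset n)

  Below : List (Subset n) → Subset n → Set
  Below Ks A = Any (A ⊆_) Ks

  below? : ∀ Ks → Decidable (Below Ks)
  below? Ks A = Any.any? (A ⊆?_) Ks

  below-independent : All (Independent N) Ks → Below Ks A → Independent N A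
  below-independent (indK ∷ _)    (here A⊆K) = hereditary N A⊆K indK
  below-independent (_    ∷ inds) (there b)  = below-independent inds b

  Augmentable : List (Subset n) → Subset n → Subset n → Set
  Augmentable Ks A B = ∃ λ e → e ∈ B × e ∉ A × Below Ks (⁅ e ⁆ ∪ A)

  augmentable? : ∀ Ks A B → Dec (Augmentable Ks A B)
  augmentable? Ks A B = any? λ e → e ∈? B ×-dec ¬? (e ∈? A) ×-dec below? Ks (⁅ e ⁆ ∪ A)

  Defect : List (Subset n) → Set
  Defect Ks = ∃₂ λ A B → Below Ks A × Below Ks B × ∣ A ∣ < ∣ B ∣ × ¬ Augmentable Ks A B

  defect? : ∀ Ks → Dec (Defect Ks)
  defect? Ks = anySubset? λ A → anySubset? λ B →
    below? Ks A ×-dec below? Ks B ×-dec ∣ A ∣ <? ∣ B ∣ ×-dec ¬? (augmentable? Ks A B)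

  belowMatroid : ∀ Ks → Below Ks ⊥ → ¬ Defect Ks → DecidableMatroid n
  belowMatroid Ks ⊥-below no-defect = record
    { matroid = record
      { Independent = Below Ks
      ; empty-indep = ⊥-below
      ; hereditary  = λ A⊆B → Any.map (⊆-trans A⊆B)
      ; augment     = augment′
      }
    ; independent? = below? Ks
    }
    where
    augment′ : Below Ks A → Below Ks B → ∣ A ∣ < ∣ B ∣ → Augmentable Ks A B
    augment′ {A} {B} a b ∣A∣<∣B∣ with augmentable? Ks A B
    ... | yes aug = aug
    ... | no ¬aug = contradiction (A , B , a , b , ∣A∣<∣B∣ , ¬aug) no-defect

  unknown : List (Subset n) → ℕ
  unknown Ks = countSubsets (¬? ∘ below? Ks)

  record Saturated (Ks₀ : List (Subset n)) : Set where
    field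
      family      : List (Subset n)
      independent : All (Independent N) family
      no-defect   : ¬ Defect family
      extends     : Below Ks₀ A → Below family A

  saturate : ∀ Ks → All (Independent N) Ks → Acc _<_ (unknown Ks) → Saturated Ks
  saturate Ks inds (acc rec) with defect? Ks
  ... | no no-defect = record { family = Ks ; independent = inds ; no-defect = no-defect ; extends = λ b → b }
  ... | yes (A , B , a , b , ∣A∣<∣B∣ , ¬aug)
    with augment N (below-independent inds a) (below-independent inds b) ∣A∣<∣B∣
  ...   | e , e∈B , e∉A , ind = grown (saturate (⁅ e ⁆ ∪ A ∷ Ks) (ind ∷ inds) (rec fewer))
    where
    fewer : unknown (⁅ e ⁆ ∪ A ∷ Ks) < unknown Ks
    fewer = countSubsets-mono-< (¬? ∘ below? (⁅ e ⁆ ∪ A ∷ Ks)) (¬? ∘ below? Ks) (λ ¬b → ¬b ∘ there)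
              (⁅ e ⁆ ∪ A) (λ ¬b → ¬b (here ⊆-refl)) (λ b → ¬aug (e , e∈B , e∉A , b))
    grown : Saturated (⁅ e ⁆ ∪ A ∷ Ks) → Saturated Ks
    grown s = record { family = family ; independent = independent ; no-defect = no-defect ; extends = extends ∘ there }
      where open Saturated s

  decidableRefinement : ∀ {k} → χ≤ N k → DecidableRefinement N k
  decidableRefinement (c , proper) = record
    { refinement = belowMatroid family (extends (here ⊆-refl)) no-defect
    ; sound      = below-independent independent
    ; colourable = c , Allₚ.tabulate⁻ (All.tabulate λ K∈ → extends (there (Any.map ⊆-reflexive K∈)))
    }
    where
    open Saturated (saturate (⊥ ∷ List.tabulate (colourClass c)) (empty-indep N ∷ Allₚ.tabulate⁺ proper)
                              (<-wellFounded _))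

module ListColouring {n t} (M : Fin t → DecidableMatroid n) where

  open DecidableMatroid using (matroid)

  rank : Fin t → Subset n → ℕ
  rank i = Rank.rank (M i)

  admitting : (Fin n → Subset t) → Fin t → Subset n
  admitting L i = tabulate (λ e → does (i ∈? L e))

  ∈-admitting⁺ : ∀ {L i e} → i ∈ L e → e ∈ admitting L i
  ∈-admitting⁺ {L} {i} = ∈-tabulate⁺ (λ e → i ∈? L e)

  ∈-admitting⁻ : ∀ {L i e} → e ∈ admitting L i → i ∈ L e
  ∈-admitting⁻ {L} {i} = ∈-tabulate⁻ (λ e → i ∈? L e)

  radoSum : (Fin n → Subset t) → Subset n → ℕ
  radoSum L A = ∑[ i < t ] rank i (A ∩ admitting L i)

  RadoCondition : (Fin n → Subset t) → Set
  RadoCondition L = ∀ A → ∣ A ∣ ≤ radoSum L A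

  Colouring : (Fin n → Subset t) → Set
  Colouring L = Σ (Fin n → Fin t) λ f → (∀ e → f e ∈ L e) × (∀ i → Independent (matroid (M i)) (colourClass f i))

  radoCondition? : ∀ L → RadoCondition L ⊎ ∃ λ A → radoSum L A < ∣ A ∣
  radoCondition? L with anySubset? (λ A → radoSum L A <? ∣ A ∣)
  ... | yes violation = inj₂ violation
  ... | no ¬violation = inj₁ λ A → ≮⇒≥ (λ violated → ¬violation (A , violated))

  colouring-mono : ∀ {L L′} → (∀ e → L′ e ⊆ L e) → Colouring L′ → Colouring L
  colouring-mono L′⊆L (f , f∈L′ , proper) = f , (λ e → L′⊆L e (f∈L′ e)) , proper

  radoCondition⇒nonempty : ∀ {L} → RadoCondition L → ∀ e → Nonempty (L e)
  radoCondition⇒nonempty {L} rado e with nonempty? (L e)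
  ... | yes nonempty = nonempty
  ... | no  empty    = contradiction (subst₂ _≤_ (∣⁅x⁆∣≡1 e) radoSum≡0 (rado ⁅ e ⁆)) λ ()
    where
    radoSum≡0 : radoSum L ⁅ e ⁆ ≡ 0
    radoSum≡0 = trans (sum-cong-≗ λ i → Rank.rank-Empty (M i) λ (x , x∈) →
      let x∈⁅e⁆ , x∈admitting = x∈p∩q⁻ ⁅ e ⁆ (admitting L i) x∈
      in empty (i , subst (λ y → i ∈ L y) (x∈⁅y⁆⇒x≡y e x∈⁅e⁆) (∈-admitting⁻ x∈admitting))) (sum-replicate-zero t)

  ∣L∣≤1⇒colouring : ∀ {L} → RadoCondition L → (∀ e → ∣ L e ∣ ≤ 1) → Colouring L
  ∣L∣≤1⇒colouring {L} rado ∣L∣≤1 = f , f∈L , proper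
    where
    f : Fin n → Fin t
    f e = proj₁ (radoCondition⇒nonempty rado e)
    f∈L : ∀ e → f e ∈ L e
    f∈L e = proj₂ (radoCondition⇒nonempty rado e)
    proper : ∀ i → Independent (matroid (M i)) (colourClass f i)
    proper i = ∣∣≤rank⇒independent (begin
      ∣ C ∣                        ≤⟨ rado C ⟩
      radoSum L C                  ≡⟨ ∑-supported-at i other-colours ⟩
      rank i (C ∩ admitting L i)   ≤⟨ rank-mono (p∩q⊆p C (admitting L i)) ⟩
      rank i C ∎)
      where
      open Rank (M i) using (∣∣≤rank⇒independent; rank-mono)
      open ≤-Reasoning
      C = colourClass f i
      other-colours : ∀ j → j ≢ i → rank j (C ∩ admitting L j) ≡ 0
      other-colours j j≢i = Rank.rank-Empty (M j) λ (x , x∈) →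
        let x∈C , x∈admitting = x∈p∩q⁻ C (admitting L j) x∈
        in j≢i (trans (∣p∣≤1⇒≡ (∣L∣≤1 x) (∈-admitting⁻ x∈admitting) (f∈L x)) (∈-tabulate⁻ (λ e → f e ≟ i) x∈C))

  dropColour : (Fin n → Subset t) → Fin n → Fin t → Fin n → Subset t
  dropColour L e₀ i e with e ≟ e₀
  ... | yes _ = L e - i
  ... | no  _ = L e

  dropColour-⊆ : ∀ {L e₀ i} e → dropColour L e₀ i e ⊆ L e
  dropColour-⊆ {L} {e₀} {i} e with e ≟ e₀
  ... | yes _ = p─q⊆p (L e) ⁅ i ⁆
  ... | no  _ = λ j∈ → j∈

  ∈-dropColour : ∀ {L e₀ i e j} → j ∈ L e → (e ≡ e₀ → j ≢ i) → j ∈ dropColour L e₀ i e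
  ∈-dropColour {L} {e₀} {i} {e} j∈ j≢i with e ≟ e₀
  ... | yes e≡e₀ = x∈p∧x≢y⇒x∈p-y j∈ (j≢i e≡e₀)
  ... | no  _    = j∈

  listSize : (Fin n → Subset t) → ℕ
  listSize L = ∑[ e < n ] ∣ L e ∣

  listSize-dropColour : ∀ {L e₀ i} → i ∈ L e₀ → listSize (dropColour L e₀ i) < listSize L
  listSize-dropColour {L} {e₀} {i} i∈ = ∑-mono-< (λ e → p⊆q⇒∣p∣≤∣q∣ (dropColour-⊆ e)) e₀ shrinks
    where
    shrinks : ∣ dropColour L e₀ i e₀ ∣ < ∣ L e₀ ∣
    shrinks with e₀ ≟ e₀
    ... | yes _   = x∈p⇒∣p-x∣<∣p∣ i∈
    ... | no  e₀≢e₀ = contradiction refl e₀≢e₀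

  radoSum-mono : ∀ {L L′ A B} → (∀ i → A ∩ admitting L i ⊆ B ∩ admitting L′ i) → radoSum L A ≤ radoSum L′ B
  radoSum-mono ⊆′ = ∑-mono-≤ λ i → Rank.rank-mono (M i) (⊆′ i)

  ∈-∩admitting-dropColour : ∀ {L e₀ i A x j} → x ∈ A → j ∈ L x → (x ≡ e₀ → j ≢ i) →
                            x ∈ A ∩ admitting (dropColour L e₀ i) j
  ∈-∩admitting-dropColour {L} {e₀} {i} {j = j} x∈A j∈ j≢i =
    x∈p∩q⁺ (x∈A , ∈-admitting⁺ {dropColour L e₀ i} {j} (∈-dropColour {L} {e₀} {i} j∈ j≢i))

  violator-contains : ∀ {L e₀ i A} → RadoCondition L → radoSum (dropColour L e₀ i) A < ∣ A ∣ → e₀ ∈ A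
  violator-contains {L} {e₀} {i} {A} rado violated with e₀ ∈? A
  ... | yes e₀∈A = e₀∈A
  ... | no  e₀∉A = contradiction (≤-trans (rado A) (radoSum-mono unchanged)) (<⇒≱ violated)
    where
    unchanged : ∀ j → A ∩ admitting L j ⊆ A ∩ admitting (dropColour L e₀ i) j
    unchanged j x∈ with x∈p∩q⁻ A (admitting L j) x∈
    ... | x∈A , x∈admitting =
      ∈-∩admitting-dropColour {L} {e₀} {i} x∈A (∈-admitting⁻ {L} {j} x∈admitting)
        λ { refl → contradiction x∈A e₀∉A }

  module _ {L : Fin n → Subset t} {e₀ : Fin n} {i₁ i₂ : Fin t} (i₁≢i₂ : i₁ ≢ i₂) {A₁ A₂ : Subset n} where

    private
      L₁ L₂ : Fin n → Subset t
      L₁ = dropColour L e₀ i₁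
      L₂ = dropColour L e₀ i₂
      W : Subset n
      W = (A₁ ∩ A₂) ∩ ∁ ⁅ e₀ ⁆

    ∪∩admitting-⊆ : e₀ ∈ A₁ → e₀ ∈ A₂ → ∀ j →
                    (A₁ ∪ A₂) ∩ admitting L j ⊆ (A₁ ∩ admitting L₁ j) ∪ (A₂ ∩ admitting L₂ j)
    ∪∩admitting-⊆ e₀∈A₁ e₀∈A₂ j {x} x∈ with x∈p∩q⁻ (A₁ ∪ A₂) (admitting L j) x∈
    ... | x∈A₁∪A₂ , x∈admitting with ∈-admitting⁻ {L} {j} x∈admitting | x ≟ e₀ | j ≟ i₁
    ...   | j∈Lx | yes refl | yes refl =
      x∈p∪q⁺ (inj₂ (∈-∩admitting-dropColour {L} {e₀} {i₂} e₀∈A₂ j∈Lx λ _ → i₁≢i₂))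
    ...   | j∈Lx | yes refl | no j≢i₁ =
      x∈p∪q⁺ (inj₁ (∈-∩admitting-dropColour {L} {e₀} {i₁} e₀∈A₁ j∈Lx λ _ → j≢i₁))
    ...   | j∈Lx | no x≢e₀  | _ = x∈p∪q⁺ (Sum.map
      (λ x∈A₁ → ∈-∩admitting-dropColour {L} {e₀} {i₁} x∈A₁ j∈Lx (flip contradiction x≢e₀))
      (λ x∈A₂ → ∈-∩admitting-dropColour {L} {e₀} {i₂} x∈A₂ j∈Lx (flip contradiction x≢e₀))
      (x∈p∪q⁻ A₁ A₂ x∈A₁∪A₂))

    ∩∩admitting-⊆ : ∀ j → W ∩ admitting L j ⊆ (A₁ ∩ admitting L₁ j) ∩ (A₂ ∩ admitting L₂ j)
    ∩∩admitting-⊆ j {x} x∈ with x∈p∩q⁻ W (admitting L j) x∈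
    ... | x∈W , x∈admitting with x∈p∩q⁻ (A₁ ∩ A₂) (∁ ⁅ e₀ ⁆) x∈W
    ...   | x∈A₁∩A₂ , x∈∁⁅e₀⁆ with x∈p∩q⁻ A₁ A₂ x∈A₁∩A₂
    ...     | x∈A₁ , x∈A₂ = x∈p∩q⁺
      ( ∈-∩admitting-dropColour {L} {e₀} {i₁} x∈A₁ j∈Lx (flip contradiction x≢e₀)
      , ∈-∩admitting-dropColour {L} {e₀} {i₂} x∈A₂ j∈Lx (flip contradiction x≢e₀) )
      where
      j∈Lx = ∈-admitting⁻ {L} {j} x∈admitting
      x≢e₀ = x∉⁅y⁆⇒x≢y (x∈∁p⇒x∉p x∈∁⁅e₀⁆)

    radoSum-submodular : e₀ ∈ A₁ → e₀ ∈ A₂ →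
                         radoSum L (A₁ ∪ A₂) + radoSum L W ≤ radoSum L₁ A₁ + radoSum L₂ A₂
    radoSum-submodular e₀∈A₁ e₀∈A₂ = begin
      radoSum L (A₁ ∪ A₂) + radoSum L W
        ≡⟨ sym (∑-distrib-+ (λ j → rank j ((A₁ ∪ A₂) ∩ admitting L j)) (λ j → rank j (W ∩ admitting L j))) ⟩
      ∑[ j < t ] (rank j ((A₁ ∪ A₂) ∩ admitting L j) + rank j (W ∩ admitting L j))
        ≤⟨ ∑-mono-≤ (λ j → Rank.rank-submodular-⊆ (M j) (∪∩admitting-⊆ e₀∈A₁ e₀∈A₂ j) (∩∩admitting-⊆ j)) ⟩
      ∑[ j < t ] (rank j (A₁ ∩ admitting L₁ j) + rank j (A₂ ∩ admitting L₂ j))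
        ≡⟨ ∑-distrib-+ (λ j → rank j (A₁ ∩ admitting L₁ j)) (λ j → rank j (A₂ ∩ admitting L₂ j)) ⟩
      radoSum L₁ A₁ + radoSum L₂ A₂ ∎
      where open ≤-Reasoning

    dropColour-clash : RadoCondition L → ¬ (radoSum L₁ A₁ < ∣ A₁ ∣ × radoSum L₂ A₂ < ∣ A₂ ∣)
    dropColour-clash rado (violated₁ , violated₂) = <⇒≱ lower upper
      where
      open ≤-Reasoning
      upper : ∣ A₁ ∣ + ∣ A₂ ∣ ≤ suc (radoSum L₁ A₁ + radoSum L₂ A₂)
      upper = begin
        ∣ A₁ ∣ + ∣ A₂ ∣                        ≤⟨ ∣p∣+∣q∣≤∣p∪q∣+1+∣p∩q-x∣ A₁ A₂ e₀ ⟩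
        ∣ A₁ ∪ A₂ ∣ + suc ∣ W ∣                ≤⟨ +-mono-≤ (rado (A₁ ∪ A₂)) (s≤s (rado W)) ⟩
        radoSum L (A₁ ∪ A₂) + suc (radoSum L W) ≡⟨ +-suc _ _ ⟩
        suc (radoSum L (A₁ ∪ A₂) + radoSum L W) ≤⟨ s≤s (radoSum-submodular (violator-contains rado violated₁)
                                                                             (violator-contains rado violated₂)) ⟩
        suc (radoSum L₁ A₁ + radoSum L₂ A₂) ∎
      lower : suc (radoSum L₁ A₁ + radoSum L₂ A₂) < ∣ A₁ ∣ + ∣ A₂ ∣
      lower = ≤-trans (s≤s (≤-reflexive (sym (+-suc _ _)))) (+-mono-≤ violated₁ violated₂)

  droppableColour : ∀ {L e₀} → RadoCondition L → 2 ≤ ∣ L e₀ ∣ →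
                    ∃ λ i → i ∈ L e₀ × RadoCondition (dropColour L e₀ i)
  droppableColour {L} {e₀} rado 2≤∣Le₀∣ with 2≤∣p∣⇒∃≢ 2≤∣Le₀∣
  ... | i₁ , i₂ , i₁∈ , i₂∈ , i₁≢i₂ with radoCondition? (dropColour L e₀ i₁) | radoCondition? (dropColour L e₀ i₂)
  ...   | inj₁ rado₁     | _              = i₁ , i₁∈ , rado₁
  ...   | inj₂ _         | inj₁ rado₂     = i₂ , i₂∈ , rado₂
  ...   | inj₂ (_ , v₁)  | inj₂ (_ , v₂)  = contradiction (v₁ , v₂) (dropColour-clash i₁≢i₂ rado)

  radoCondition⇒colouring : ∀ L → RadoCondition L → Colouring L
  radoCondition⇒colouring L = colour L (<-wellFounded (listSize L))
    where
    colour : ∀ L → Acc _<_ (listSize L) → RadoCondition L → Colouring L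
    colour L (acc smaller) rado with any? (λ e → 2 ≤? ∣ L e ∣)
    ... | no  ∄long = ∣L∣≤1⇒colouring rado (λ e → ≤-pred (≰⇒> (∄long ∘ (e ,_))))
    ... | yes (e₀ , long) with droppableColour rado long
    ...   | i , i∈ , rado′ =
      colouring-mono dropColour-⊆ (colour (dropColour L e₀ i) (smaller (listSize-dropColour i∈)) rado′)

  uniform-radoCondition : ∀ {L k} .{{_ : NonZero k}} → (∀ i X → ∣ X ∣ ≤ k * rank i X) → (∀ e → ∣ L e ∣ ≡ k) →
                          RadoCondition L
  uniform-radoCondition {L} {k} bound ∣L∣≡k A = *-cancelˡ-≤ k (begin
    k * ∣ A ∣                                 ≡⟨ sym (∑∣A∩column∣≡k*∣A∣ (λ e i → does (i ∈? L e)) A rows) ⟩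
    ∑[ i < t ] ∣ A ∩ admitting L i ∣          ≤⟨ ∑-mono-≤ (λ i → bound i (A ∩ admitting L i)) ⟩
    ∑[ i < t ] (k * rank i (A ∩ admitting L i)) ≡⟨ sym (*-distribˡ-sum k (λ i → rank i (A ∩ admitting L i))) ⟩
    k * radoSum L A ∎)
    where
    open ≤-Reasoning
    rows : ∀ {e} → e ∈ A → ∣ tabulate (λ i → does (i ∈? L e)) ∣ ≡ k
    rows {e} _ = trans (cong ∣_∣ (tabulate-∈?≡ (L e))) (∣L∣≡k e)

theorem3 : (n k t : ℕ) → NonZero k → k ≤ t →
           (N : Fin t → Matroid n) → (∀ i → χ≤ (N i) k) →
           (L : Fin n → Subset t) → (∀ e → ∣ L e ∣ ≡ k) →
           Σ (Fin n → Fin t) λ f →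
             (∀ e → f e ∈ L e) × (∀ i → Independent (N i) (colourClass f i))
theorem3 n k t k≢0 _ N χ≤k L ∣L∣≡k =
  let f , f∈L , proper = radoCondition⇒colouring L rado
  in  f , f∈L , λ i → DecidableRefinement.sound (R i) (proper i)
  where
  R : ∀ i → DecidableRefinement (N i) k
  R i = Saturation.decidableRefinement (N i) (χ≤k i)
  open ListColouring (λ i → DecidableRefinement.refinement (R i))
  rado : RadoCondition L
  rado = uniform-radoCondition {{k≢0}} (λ i → Rank.∣∣≤k*rank _ (DecidableRefinement.colourable (R i))) ∣L∣≡k
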